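{- Consider the algorithm described in the context run on an instance of the maximum-weight online bipartite left-perfect matching problem with budget $k=4$. For each timestep $t\in\{1,\dots,n\}$, $$p_t\ \ge\ w(u_t,M^\star(u_t))-\ell^t_{M^\star(u_t)}.$$
   Context: Problem and notation. $G=(L\cup R,E)$ is a complete bipartite graph with nonnegative edge weights $w$, $n:=|L|\le|R|$. The algorithm knows $R$ in advance; at time $t=1,\dots,n$ the vertex $u_t\in L$ arrives with the weights of its incident edges; the algorithm must maintain a left-perfect matching (covering all arrived vertices of $L$), changing it at each step via at most $4$ (re)assignments (the number of vertices incident to the symmetric difference of consecutive matchings), and matched vertices stay matched. Algorithm: with current matching $M_t$, it considers all augmenting paths (paths between two distinct vertices uncovered by $M_t$, alternating between non-$M_t$ and $M_t$ edges) in the current graph containing $u_t$ with at most $4$ vertices, and picks one, $P$, maximizing $\sum_{e\in M_t\triangle P}w(e)-\sum_{e\in M_t}w(e)$; it sets $M_{t+1}:=M_t\triangle P$. Here $M_1=\emptyset$ and $M_t$ is the matching at the beginning of time $t$ ($M_{n+1}$ is the final one). $R^t_{\mathrm{exp}}$ is the set of vertices of $R$ not covered by $M_t$. For a matching $M$ and a covered vertex $x$, $M(x)$ denotes its partner. The marginal profit is $p_t:=\sum_{e\in M_{t+1}}w(e)-\sum_{e\in M_t}w(e)$. For $v\in R$, the loss is $\ell^t_v:=w(M_t(v),v)-\max_{v'\in R^t_{\mathrm{exp}}}w(M_t(v),v')$ if $v$ is covered by $M_t$ and $\ell^t_v:=0$ otherwise, with $\max\emptyset:=0$. $M^\star$ is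 a maximum-weight left-perfect matching in $G$.
   Formalization: The edge weights $w$ are nonnegative rationals. -}

module Defs where

open import Data.Bool using (Bool; true; false; _∨_; _∧_; _xor_; if_then_else_; not)
open import Data.Nat using (ℕ; zero; suc; _≤_)
open import Data.Fin using (Fin; toℕ; _≟_)
import Data.Fin as F
open import Data.Maybe using (Maybe; just; nothing)
open import Data.Sum using (_⊎_; inj₁; inj₂)
open import Data.Product using (Σ; ∃; _×_; _,_)
open import Data.List using (List; []; _∷_; _∷ʳ_; length)
open import Data.List.Membership.Propositional using (_∈_)
open import Data.List.Relation.Unary.Unique.Propositional using (Unique)
open import Data.Unit using (⊤)
open import Data.Empty using (⊥)
open import Relation.Nullary using (¬_)
open import Relation.Nullary.Decidable using (⌊_⌋)
open import Relation.Binary.PropositionalEquality using (_≡_)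
open import Data.Rational using (ℚ; 0ℚ; _+_; _-_; _⊔_)
import Data.Rational as Q

sumFin : ∀ {k} → (Fin k → ℚ) → ℚ
sumFin {zero}  f = 0ℚ
sumFin {suc k} f = f F.zero + sumFin (λ i → f (F.suc i))

anyFin : ∀ {k} → (Fin k → Bool) → Bool
anyFin {zero}  p = false
anyFin {suc k} p = p F.zero ∨ anyFin (λ i → p (F.suc i))

findFin : ∀ {k} → (Fin k → Bool) → Maybe (Fin k)
findFin {zero}  p = nothing
findFin {suc k} p with p F.zero
... | true  = just F.zero
... | false with findFin (λ i → p (F.suc i))
...   | just i  = just (F.suc i)
...   | nothing = nothing

maxOn : ∀ {k} → (Fin k → Bool) → (Fin k → ℚ) → Maybe ℚ
maxOn {zero}  p f = nothing
maxOn {suc k} p f with p F.zero | maxOn (λ i → p (F.suc i)) (λ i → f (F.suc i))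
... | true  | just r  = just (f F.zero ⊔ r)
... | true  | nothing = just (f F.zero)
... | false | r       = r

maxOr0 : Maybe ℚ → ℚ
maxOr0 (just r) = r
maxOr0 nothing  = 0ℚ

-- The bipartite graph: L = Fin n (u_t is the vertex with index t,
-- times are 0-indexed: time t : Fin n), R = Fin m.
-- Edge sets of K_{L,R} are given by their characteristic function.

EdgeSet : ℕ → ℕ → Set
EdgeSet n m = Fin n → Fin m → Bool

Weights : ℕ → ℕ → Set
Weights n m = Fin n → Fin m → ℚ

V : ℕ → ℕ → Set
V n m = Fin n ⊎ Fin m

_△_ : ∀ {n m} → EdgeSet n m → EdgeSet n m → EdgeSet n m
(A △ B) i j = A i j xor B i j

weight : ∀ {n m} → Weights n m → EdgeSet n m → ℚ
weight w M = sumFin (λ i → sumFin (λ j → if M i j then w i j else 0ℚ))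

IsMatching : ∀ {n m} → EdgeSet n m → Set
IsMatching {n} {m} M =
  (∀ (i : Fin n) (j j′ : Fin m) → M i j ≡ true → M i j′ ≡ true → j ≡ j′) ×
  (∀ (i i′ : Fin n) (j : Fin m) → M i j ≡ true → M i′ j ≡ true → i ≡ i′)

coveredL : ∀ {n m} → EdgeSet n m → Fin n → Bool
coveredL M i = anyFin (λ j → M i j)

coveredR : ∀ {n m} → EdgeSet n m → Fin m → Bool
coveredR M j = anyFin (λ i → M i j)

covered : ∀ {n m} → EdgeSet n m → V n m → Bool
covered M (inj₁ i) = coveredL M i
covered M (inj₂ j) = coveredR M j

IsLeftPerfectMatching : ∀ {n m} → EdgeSet n m → Set
IsLeftPerfectMatching {n} {m} M = IsMatching M × (∀ (i : Fin n) → ∃ λ (j : Fin m) → M i j ≡ true)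

IsMaxWeightLPM : ∀ {n m} → Weights n m → EdgeSet n m → Set
IsMaxWeightLPM w M = IsLeftPerfectMatching M ×
  (∀ M′ → IsLeftPerfectMatching M′ → weight w M′ Q.≤ weight w M)

-- Paths in the current graph at time t: left vertices u_0..u_t
-- (those with toℕ i ≤ toℕ t) together with all of R, complete bipartite.

Adj : ∀ {n m} → Fin n → V n m → V n m → Set
Adj t (inj₁ i) (inj₂ j) = toℕ i ≤ toℕ t
Adj t (inj₂ j) (inj₁ i) = toℕ i ≤ toℕ t
Adj t (inj₁ _) (inj₁ _) = ⊥
Adj t (inj₂ _) (inj₂ _) = ⊥

isEdge : ∀ {n m} → V n m → V n m → Fin n → Fin m → Bool
isEdge (inj₁ a) (inj₂ b) i j = ⌊ a ≟ i ⌋ ∧ ⌊ b ≟ j ⌋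
isEdge (inj₂ b) (inj₁ a) i j = ⌊ a ≟ i ⌋ ∧ ⌊ b ≟ j ⌋
isEdge (inj₁ _) (inj₁ _) i j = false
isEdge (inj₂ _) (inj₂ _) i j = false

inM : ∀ {n m} → EdgeSet n m → V n m → V n m → Bool
inM M (inj₁ a) (inj₂ b) = M a b
inM M (inj₂ b) (inj₁ a) = M a b
inM M (inj₁ _) (inj₁ _) = false
inM M (inj₂ _) (inj₂ _) = false

Walk : ∀ {n m} → Fin n → List (V n m) → Set
Walk t (a ∷ b ∷ rest) = Adj t a b × Walk t (b ∷ rest)
Walk t _ = ⊤

Alternating : ∀ {n m} → EdgeSet n m → List (V n m) → Set
Alternating M (a ∷ b ∷ c ∷ rest) = (inM M a b xor inM M b c ≡ true) × Alternating M (b ∷ c ∷ rest)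
Alternating M _ = ⊤

pathEdges : ∀ {n m} → List (V n m) → EdgeSet n m
pathEdges (a ∷ b ∷ rest) i j = isEdge a b i j ∨ pathEdges (b ∷ rest) i j
pathEdges _ i j = false

record AugPath {n m} (M : EdgeSet n m) (t : Fin n) : Set where
  field
    a b  : V n m
    mid  : List (V n m)
  vertices : List (V n m)
  vertices = a ∷ (mid ∷ʳ b)
  field
    simple      : Unique vertices
    walk        : Walk t vertices
    alternating : Alternating M vertices
    a-free      : covered M a ≡ false
    b-free      : covered M b ≡ false
    a≢b         : ¬ (a ≡ b)
    contains-ut : inj₁ t ∈ vertices
    short       : length vertices ≤ 4
  edges : EdgeSet n m
  edges = pathEdges vertices

gain : ∀ {n m} → Weights n m → (M : EdgeSet n m) → {t : Fin n} → AugPath M t → ℚ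
gain w M P = weight w (M △ AugPath.edges P) - weight w M

-- One step of the algorithm at time t: M′ = M △ P for a gain-maximizing P
-- (any tie-breaking allowed).
Step : ∀ {n m} → Weights n m → EdgeSet n m → Fin n → EdgeSet n m → Set
Step w M t M′ = Σ (AugPath M t) λ P →
  (∀ (Q : AugPath M t) → gain w M Q Q.≤ gain w M P) ×
  (∀ i j → M′ i j ≡ (M △ AugPath.edges P) i j)

-- A run of the algorithm: Ms k is the matching at the beginning of time k
-- (0-indexed, so Ms 0 = M_1 = ∅ and Ms n is the final matching).
IsRun : ∀ {n m} → Weights n m → (ℕ → EdgeSet n m) → Set
IsRun {n} w Ms = (∀ i j → Ms 0 i j ≡ false) ×
  (∀ (t : Fin n) → Step w (Ms (toℕ t)) t (Ms (suc (toℕ t))))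

profit : ∀ {n m} → Weights n m → (ℕ → EdgeSet n m) → Fin n → ℚ
profit w Ms t = weight w (Ms (suc (toℕ t))) - weight w (Ms (toℕ t))

loss : ∀ {n m} → Weights n m → EdgeSet n m → Fin m → ℚ
loss w M v with findFin (λ i → M i v)
... | just u  = w u v - maxOr0 (maxOn (λ v′ → not (coveredR M v′)) (λ v′ → w u v′))
... | nothing = 0ℚ

-- Every augmenting path chosen before time t uses only left vertices up to
-- its own time, so M_t matches only u_0, …, u_{t-1} and u_t is free.  If
-- M*(u_t) = v is free, the single edge u_t v is an admissible augmenting path
-- of gain w(u_t, v), and ℓ_v = 0.  If v is matched to u, take the free v′
-- maximising w(u, v′); one exists because the path the algorithm picks has a
-- free end in R.  Then u_t v u v′ is admissible with gain
-- w(u_t, v) − w(u, v) + w(u, v′) = w(u_t, v) − ℓ_v.  Since p_t is the maximum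
-- gain, it dominates both.  Gains are computed as sums of ±w over the
-- toggled edges: w(M △ E) = w(M) + Σ_{e ∈ E} (e ∈ M ? −w(e) : w(e)).

module Submission where

open import Defs
open import Data.Nat using (ℕ; zero; suc; _≤_; _<_; z≤n; s≤s)
open import Data.Nat.Properties using (≤-refl; <⇒≤; <-irrefl; m<n⇒m<1+n)
open import Data.Fin using (Fin; toℕ; _≟_; fromℕ<)
import Data.Fin as F
open import Data.Fin.Properties using (toℕ<n; toℕ-fromℕ<; punchInᵢ≢i)
open import Data.Bool using (Bool; true; false; _∨_; _∧_; _xor_; not; if_then_else_)
open import Data.Bool.Properties using (¬-not; not-injective)
open import Data.Maybe using (just; nothing)
open import Data.Product using (∃; _×_; _,_; proj₁; proj₂)
open import Data.Sum using (_⊎_; inj₁; inj₂; [_,_]′)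
open import Data.Sum.Properties using (inj₁-injective; inj₂-injective)
open import Data.List using (List; []; _∷_)
open import Data.List.Relation.Unary.All using ([]; _∷_)
open import Data.List.Relation.Unary.AllPairs using ([]; _∷_)
open import Data.List.Relation.Unary.Any using (here)
open import Data.Unit using (tt)
open import Data.Empty using (⊥-elim)
open import Data.Vec.Functional using (head; tail; removeAt)
open import Function using (_∘_)
open import Relation.Nullary using (¬_; yes; no; contradiction)
open import Relation.Nullary.Decidable using (⌊_⌋)
open import Relation.Binary.PropositionalEquality
open ≡-Reasoning
open import Data.Rational using (ℚ; 0ℚ; _+_; _-_; -_)
import Data.Rational as Q
open import Data.Rational.Properties
  using (+-identityʳ; +-inverseʳ; +-identityˡ; ⊔-sel; +-0-commutativeMonoid; +-0-abelianGroup)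
open import Data.Rational.Solver using (module +-*-Solver)
open import Algebra.Properties.CommutativeMonoid.Sum +-0-commutativeMonoid
  using (sum; sum-syntax; sum-remove; sum-cong-≗; sum-replicate-zero; ∑-distrib-+)
open import Algebra.Properties.AbelianGroup +-0-abelianGroup using (xyx⁻¹≈y)

private
  variable
    k n m : ℕ

sumFin≗sum : (f : Fin k → ℚ) → sumFin f ≡ sum f
sumFin≗sum {zero}  f = refl
sumFin≗sum {suc k} f = cong (head f +_) (sumFin≗sum (tail f))

sum-supportedAt : (a : Fin k) (g : Fin k → ℚ) → (∀ i → i ≢ a → g i ≡ 0ℚ) → sum g ≡ g a
sum-supportedAt {suc k} a g vanish = begin
  sum g                     ≡⟨ sum-remove {i = a} g ⟩
  g a + sum (removeAt g a)  ≡⟨ cong (g a +_) (sum-cong-≗ (λ j → vanish _ (punchInᵢ≢i a j))) ⟩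
  g a + ∑[ _ < k ] 0ℚ       ≡⟨ cong (g a +_) (sum-replicate-zero k) ⟩
  g a + 0ℚ                  ≡⟨ +-identityʳ (g a) ⟩
  g a                       ∎

∑-indicator : (a : Fin k) (f : Fin k → ℚ) → ∑[ i < k ] (if ⌊ a ≟ i ⌋ then f i else 0ℚ) ≡ f a
∑-indicator a f = trans (sum-supportedAt a _ off-a) at-a
  where
  off-a : ∀ i → i ≢ a → (if ⌊ a ≟ i ⌋ then f i else 0ℚ) ≡ 0ℚ
  off-a i i≢a with a ≟ i
  ... | yes a≡i = contradiction (sym a≡i) i≢a
  ... | no _    = refl
  at-a : (if ⌊ a ≟ a ⌋ then f a else 0ℚ) ≡ f a
  at-a with a ≟ a
  ... | yes _   = refl
  ... | no a≢a  = contradiction refl a≢a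

∑∑-distrib-+ : (f g : Fin n → Fin m → ℚ) →
  ∑[ i < n ] ∑[ j < m ] (f i j + g i j) ≡ ∑[ i < n ] ∑[ j < m ] f i j + ∑[ i < n ] ∑[ j < m ] g i j
∑∑-distrib-+ {n} {m} f g =
  trans (sum-cong-≗ (λ i → ∑-distrib-+ (f i) (g i))) (∑-distrib-+ (λ i → ∑[ j < m ] f i j) _)

anyFin≡false⇒none : (p : Fin k → Bool) → anyFin p ≡ false → ∀ i → p i ≡ false
anyFin≡false⇒none {suc k} p none i with p F.zero in p0
anyFin≡false⇒none {suc k} p ()   i         | true
anyFin≡false⇒none {suc k} p none F.zero    | false = p0
anyFin≡false⇒none {suc k} p none (F.suc i) | false = anyFin≡false⇒none (tail p) none i

none⇒anyFin≡false : (p : Fin k → Bool) → (∀ i → p i ≡ false) → anyFin p ≡ false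
none⇒anyFin≡false {zero}  p none = refl
none⇒anyFin≡false {suc k} p none rewrite none F.zero = none⇒anyFin≡false (tail p) (none ∘ F.suc)

findFin-just : (p : Fin k → Bool) {i : Fin k} → findFin p ≡ just i → p i ≡ true
findFin-just {suc k} p found with p F.zero in p0
findFin-just {suc k} p refl | true = p0
... | false with findFin (tail p) in found′
findFin-just {suc k} p refl | false | just _ = findFin-just (tail p) found′

findFin-nothing : (p : Fin k → Bool) → findFin p ≡ nothing → ∀ i → p i ≡ false
findFin-nothing {suc k} p none i with p F.zero in p0
findFin-nothing {suc k} p () i | true
... | false with findFin (tail p) in none′
findFin-nothing {suc k} p () i         | false | just _
findFin-nothing {suc k} p _ F.zero     | false | nothing = p0
findFin-nothing {suc k} p _ (F.suc i)  | false | nothing = findFin-nothing (tail p) none′ i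

maxOn-just : (p : Fin k → Bool) (f : Fin k → ℚ) {r : ℚ} →
  maxOn p f ≡ just r → ∃ λ i → p i ≡ true × f i ≡ r
maxOn-just {suc k} p f found with p F.zero in p0 | maxOn (tail p) (tail f) in rest
... | true | just r with found | ⊔-sel (f F.zero) r
...   | refl | inj₁ f0⊔r≡f0 = F.zero , p0 , sym f0⊔r≡f0
...   | refl | inj₂ f0⊔r≡r with maxOn-just (tail p) (tail f) rest
...     | i , pi , fi≡r = F.suc i , pi , trans fi≡r (sym f0⊔r≡r)
maxOn-just {suc k} p f refl | true  | nothing = F.zero , p0 , refl
maxOn-just {suc k} p f refl | false | just r with maxOn-just (tail p) (tail f) rest
...   | i , pi , fi≡r = F.suc i , pi , fi≡r

maxOn-nothing : (p : Fin k → Bool) (f : Fin k → ℚ) → maxOn p f ≡ nothing → ∀ i → p i ≢ true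
maxOn-nothing {suc k} p f none i pi with p F.zero in p0 | maxOn (tail p) (tail f) in rest
maxOn-nothing {suc k} p f () i pi         | true  | just _
maxOn-nothing {suc k} p f () i pi         | true  | nothing
maxOn-nothing {suc k} p f () i pi         | false | just _
maxOn-nothing {suc k} p f _ F.zero pi     | false | nothing = contradiction (trans (sym p0) pi) λ ()
maxOn-nothing {suc k} p f _ (F.suc i) pi  | false | nothing = maxOn-nothing (tail p) (tail f) rest i pi

∅ : EdgeSet n m
∅ _ _ = false

_∪_ : EdgeSet n m → EdgeSet n m → EdgeSet n m
(E ∪ F) i j = E i j ∨ F i j

-- isEdge a b is singleEdge on the underlying pair of vertices, so
-- pathEdges (a ∷ b ∷ vs) unfolds to singleEdge _ _ ∪ pathEdges (b ∷ vs).
singleEdge : Fin n → Fin m → EdgeSet n m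
singleEdge a b i j = ⌊ a ≟ i ⌋ ∧ ⌊ b ≟ j ⌋

singleEdge-true : ∀ {a i : Fin n} {b j : Fin m} → singleEdge a b i j ≡ true → a ≡ i × b ≡ j
singleEdge-true {a = a} {i} {b} {j} e with a ≟ i | b ≟ j | e
... | yes a≡i | yes b≡j | _  = a≡i , b≡j
... | yes _   | no _    | ()
... | no _    | _       | ()

singleEdge-false : ∀ {a i : Fin n} {b j : Fin m} → ¬ (a ≡ i × b ≡ j) → singleEdge a b i j ≡ false
singleEdge-false ne = ¬-not (ne ∘ singleEdge-true)

Disjoint : EdgeSet n m → EdgeSet n m → Set
Disjoint E F = ∀ i j → E i j ≡ true → F i j ≡ false

singleEdge-disjoint : ∀ {E : EdgeSet n m} {a b} → E a b ≡ false → Disjoint (singleEdge a b) E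
singleEdge-disjoint {a = a} {b} Eab i j e with singleEdge-true {a = a} {i} {b} {j} e
... | refl , refl = Eab

toggleWeight : Weights n m → EdgeSet n m → Fin n → Fin m → ℚ
toggleWeight w M i j = if M i j then - w i j else w i j

toggleWeight-unmatched : ∀ (w : Weights n m) (M : EdgeSet n m) {i j} →
  M i j ≡ false → toggleWeight w M i j ≡ w i j
toggleWeight-unmatched w M {i} {j} e = cong (if_then - w i j else w i j) e

toggleWeight-matched : ∀ (w : Weights n m) (M : EdgeSet n m) {i j} →
  M i j ≡ true → toggleWeight w M i j ≡ - w i j
toggleWeight-matched w M {i} {j} e = cong (if_then - w i j else w i j) e

toggleGain : Weights n m → EdgeSet n m → EdgeSet n m → ℚ
toggleGain {n} {m} w M E = ∑[ i < n ] ∑[ j < m ] (if E i j then toggleWeight w M i j else 0ℚ)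

weight≡∑∑ : (w : Weights n m) (M : EdgeSet n m) →
  weight w M ≡ ∑[ i < n ] ∑[ j < m ] (if M i j then w i j else 0ℚ)
weight≡∑∑ {n} {m} w M =
  trans (sumFin≗sum (λ i → sumFin (entry i))) (sum-cong-≗ (λ i → sumFin≗sum (entry i)))
  where
  entry : Fin n → Fin m → ℚ
  entry i j = if M i j then w i j else 0ℚ

weight-cong : (w : Weights n m) {A B : EdgeSet n m} → (∀ i j → A i j ≡ B i j) → weight w A ≡ weight w B
weight-cong {n} {m} w {A} {B} A≗B = begin
  weight w A                                         ≡⟨ weight≡∑∑ w A ⟩
  ∑[ i < n ] ∑[ j < m ] (if A i j then w i j else 0ℚ)
    ≡⟨ sum-cong-≗ (λ i → sum-cong-≗ (λ j → cong (if_then w i j else 0ℚ) (A≗B i j))) ⟩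
  ∑[ i < n ] ∑[ j < m ] (if B i j then w i j else 0ℚ) ≡⟨ weight≡∑∑ w B ⟨
  weight w B                                         ∎

if-xor : ∀ x y (s : ℚ) →
  (if x xor y then s else 0ℚ) ≡ (if x then s else 0ℚ) + (if y then (if x then - s else s) else 0ℚ)
if-xor true  true  s = sym (+-inverseʳ s)
if-xor true  false s = sym (+-identityʳ s)
if-xor false true  s = sym (+-identityˡ s)
if-xor false false s = sym (+-identityʳ 0ℚ)

weight-△ : (w : Weights n m) (M E : EdgeSet n m) → weight w (M △ E) ≡ weight w M + toggleGain w M E
weight-△ {n} {m} w M E = begin
  weight w (M △ E)
    ≡⟨ weight≡∑∑ w (M △ E) ⟩
  ∑[ i < n ] ∑[ j < m ] (if M i j xor E i j then w i j else 0ℚ)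
    ≡⟨ sum-cong-≗ (λ i → sum-cong-≗ (λ j → if-xor (M i j) (E i j) (w i j))) ⟩
  ∑[ i < n ] ∑[ j < m ] (onM i j + toggled i j)
    ≡⟨ ∑∑-distrib-+ onM toggled ⟩
  ∑[ i < n ] ∑[ j < m ] onM i j + toggleGain w M E
    ≡⟨ cong (_+ toggleGain w M E) (weight≡∑∑ w M) ⟨
  weight w M + toggleGain w M E
    ∎
  where
  onM toggled : Fin n → Fin m → ℚ
  onM i j     = if M i j then w i j else 0ℚ
  toggled i j = if E i j then toggleWeight w M i j else 0ℚ

weight-△-gain : (w : Weights n m) (M E : EdgeSet n m) → weight w (M △ E) - weight w M ≡ toggleGain w M E
weight-△-gain w M E = trans (cong (_- weight w M) (weight-△ w M E)) (xyx⁻¹≈y (weight w M) (toggleGain w M E))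

toggleGain-∅ : (w : Weights n m) (M : EdgeSet n m) → toggleGain w M ∅ ≡ 0ℚ
toggleGain-∅ {n} {m} w M = trans (sum-cong-≗ {n} (λ _ → sum-replicate-zero m)) (sum-replicate-zero n)

if-∨ : ∀ x y (s : ℚ) → (x ≡ true → y ≡ false) →
  (if x ∨ y then s else 0ℚ) ≡ (if x then s else 0ℚ) + (if y then s else 0ℚ)
if-∨ true  y     s disjoint rewrite disjoint refl = sym (+-identityʳ s)
if-∨ false true  s _ = sym (+-identityˡ s)
if-∨ false false s _ = sym (+-identityʳ 0ℚ)

toggleGain-∪ : (w : Weights n m) (M : EdgeSet n m) {E F : EdgeSet n m} → Disjoint E F →
  toggleGain w M (E ∪ F) ≡ toggleGain w M E + toggleGain w M F
toggleGain-∪ w M {E} {F} disjoint = trans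
  (sum-cong-≗ (λ i → sum-cong-≗ (λ j → if-∨ (E i j) (F i j) (toggleWeight w M i j) (disjoint i j))))
  (∑∑-distrib-+ (λ i j → if E i j then toggleWeight w M i j else 0ℚ) _)

toggleGain-singleEdge : (w : Weights n m) (M : EdgeSet n m) (a : Fin n) (b : Fin m) →
  toggleGain w M (singleEdge a b) ≡ toggleWeight w M a b
toggleGain-singleEdge {n} {m} w M a b =
  trans (sum-cong-≗ row) (∑-indicator a (λ i → toggleWeight w M i b))
  where
  row : ∀ i → ∑[ j < m ] (if singleEdge a b i j then toggleWeight w M i j else 0ℚ)
            ≡ (if ⌊ a ≟ i ⌋ then toggleWeight w M i b else 0ℚ)
  row i with ⌊ a ≟ i ⌋
  ... | true  = ∑-indicator b (toggleWeight w M i)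
  ... | false = sum-replicate-zero m

toggleGain-insert : (w : Weights n m) (M : EdgeSet n m) {E : EdgeSet n m} {a : Fin n} {b : Fin m} →
  E a b ≡ false →
  toggleGain w M (singleEdge a b ∪ E) ≡ toggleWeight w M a b + toggleGain w M E
toggleGain-insert w M {E} {a} {b} Eab = trans
  (toggleGain-∪ w M {singleEdge a b} {E} (singleEdge-disjoint {E = E} {a} {b} Eab))
  (cong (_+ toggleGain w M E) (toggleGain-singleEdge w M a b))

MatchedBefore : EdgeSet n m → ℕ → Set
MatchedBefore {n} {m} M k = ∀ (i : Fin n) (j : Fin m) → M i j ≡ true → toℕ i < k

isEdge-left≤ : ∀ {t : Fin n} (a b : V n m) {i j} → Adj t a b → isEdge a b i j ≡ true → toℕ i ≤ toℕ t
isEdge-left≤ (inj₁ x) (inj₂ y) {i} {j} x≤t e with singleEdge-true {a = x} {i} {y} {j} e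
... | refl , refl = x≤t
isEdge-left≤ (inj₂ y) (inj₁ x) {i} {j} x≤t e with singleEdge-true {a = x} {i} {y} {j} e
... | refl , refl = x≤t

∨≡true : ∀ x {y} → x ∨ y ≡ true → x ≡ true ⊎ y ≡ true
∨≡true true  _ = inj₁ refl
∨≡true false e = inj₂ e

pathEdges-left≤ : ∀ {t : Fin n} (vs : List (V n m)) → Walk t vs →
  ∀ i j → pathEdges vs i j ≡ true → toℕ i ≤ toℕ t
pathEdges-left≤ (a ∷ b ∷ vs) (ab , walk) i j e =
  [ isEdge-left≤ a b ab , pathEdges-left≤ (b ∷ vs) walk i j ]′ (∨≡true (isEdge a b i j) e)
pathEdges-left≤ (_ ∷ []) _ _ _ ()
pathEdges-left≤ [] _ _ _ ()

step-matchedBefore : ∀ {w : Weights n m} {M M′ : EdgeSet n m} {t : Fin n} →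
  Step w M t M′ → MatchedBefore M (toℕ t) → MatchedBefore M′ (suc (toℕ t))
step-matchedBefore {M = M} (P , _ , M′≡) before i j e with M i j in old
... | true  = m<n⇒m<1+n (before i j old)
... | false = s≤s (pathEdges-left≤ (AugPath.vertices P) (AugPath.walk P) i j
                    (trans (cong (_xor AugPath.edges P i j) (sym old)) (trans (sym (M′≡ i j)) e)))

run-matchedBefore : ∀ {w : Weights n m} {Ms : ℕ → EdgeSet n m} →
  IsRun w Ms → ∀ k → k ≤ n → MatchedBefore (Ms k) k
run-matchedBefore (empty , _) zero _ i j e = contradiction (trans (sym (empty i j)) e) λ ()
run-matchedBefore {Ms = Ms} run@(_ , steps) (suc k) k<n =
  subst (λ k → MatchedBefore (Ms (suc k)) (suc k)) (toℕ-fromℕ< k<n)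
    (step-matchedBefore (steps (fromℕ< k<n))
      (subst (λ k → MatchedBefore (Ms k) k) (sym (toℕ-fromℕ< k<n)) (run-matchedBefore run k (<⇒≤ k<n))))

-- If both ends lie in L the walk has the shape L R L; both of its edges
-- miss M because the ends are uncovered, which contradicts alternation.
augPath-uncoveredRight : ∀ {M : EdgeSet n m} {t : Fin n} → AugPath M t → ∃ λ j → coveredR M j ≡ false
augPath-uncoveredRight record { a = inj₂ j ; a-free = j-free } = j , j-free
augPath-uncoveredRight record { a = inj₁ _ ; b = inj₂ j ; b-free = j-free } = j , j-free
augPath-uncoveredRight {M = M} record
  { a = inj₁ x ; b = inj₁ y ; mid = inj₂ z ∷ [] ; alternating = alt , _ ; a-free = x-free ; b-free = y-free }
  with trans (sym alt) (cong₂ _xor_ (anyFin≡false⇒none (M x) x-free z) (anyFin≡false⇒none (M y) y-free z))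
... | ()
augPath-uncoveredRight record { a = inj₁ _ ; b = inj₁ _ ; mid = [] ; walk = () , _ }
augPath-uncoveredRight record { a = inj₁ _ ; b = inj₁ _ ; mid = inj₁ _ ∷ _ ; walk = () , _ }
augPath-uncoveredRight record { a = inj₁ _ ; b = inj₁ _ ; mid = inj₂ _ ∷ inj₂ _ ∷ _ ; walk = _ , () , _ }
augPath-uncoveredRight record { a = inj₁ _ ; b = inj₁ _ ; mid = inj₂ _ ∷ inj₁ _ ∷ [] ; walk = _ , _ , () , _ }
augPath-uncoveredRight record { a = inj₁ _ ; b = inj₁ _ ; mid = _ ∷ _ ∷ _ ∷ [] ; short = s≤s (s≤s (s≤s (s≤s ()))) }
augPath-uncoveredRight record { a = inj₁ _ ; b = inj₁ _ ; mid = _ ∷ _ ∷ _ ∷ _ ∷ _ ; short = s≤s (s≤s (s≤s (s≤s ()))) }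

module _ {M : EdgeSet n m} {t : Fin n} (t-free : coveredL M t ≡ false) where

  private
    t-unmatched : ∀ j → M t j ≡ false
    t-unmatched = anyFin≡false⇒none (M t) t-free

  edgePath : {v : Fin m} → coveredR M v ≡ false → AugPath M t
  edgePath {v} v-free = record
    { a = inj₁ t ; b = inj₂ v ; mid = []
    ; simple      = ((λ ()) ∷ []) ∷ [] ∷ []
    ; walk        = ≤-refl , tt
    ; alternating = tt
    ; a-free = t-free ; b-free = v-free ; a≢b = λ ()
    ; contains-ut = here refl
    ; short       = s≤s (s≤s z≤n)
    }

  edgePath-gain : (w : Weights n m) {v : Fin m} (v-free : coveredR M v ≡ false) →
    gain w M (edgePath v-free) ≡ w t v
  edgePath-gain w {v} v-free = begin
    gain w M (edgePath v-free)               ≡⟨ weight-△-gain w M _ ⟩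
    toggleGain w M (singleEdge t v ∪ ∅)      ≡⟨ toggleGain-insert w M refl ⟩
    toggleWeight w M t v + toggleGain w M ∅
      ≡⟨ cong₂ _+_ (toggleWeight-unmatched w M (t-unmatched v)) (toggleGain-∅ w M) ⟩
    w t v + 0ℚ                               ≡⟨ +-identityʳ (w t v) ⟩
    w t v                                    ∎

  module _ {u : Fin n} {v v′ : Fin m}
           (u<t : toℕ u < toℕ t) (uv∈M : M u v ≡ true) (v′-free : coveredR M v′ ≡ false) where

    private
      uv′∉M : M u v′ ≡ false
      uv′∉M = anyFin≡false⇒none (λ i → M i v′) v′-free u

      t≢u : t ≢ u
      t≢u refl = <-irrefl refl u<t

      v≢v′ : v ≢ v′
      v≢v′ refl = contradiction (trans (sym uv∈M) uv′∉M) λ ()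

    threeEdgePath : AugPath M t
    threeEdgePath = record
      { a = inj₁ t ; b = inj₂ v′ ; mid = inj₂ v ∷ inj₁ u ∷ []
      ; simple      = ((λ ()) ∷ t≢u ∘ inj₁-injective ∷ (λ ()) ∷ [])
                    ∷ ((λ ()) ∷ v≢v′ ∘ inj₂-injective ∷ [])
                    ∷ ((λ ()) ∷ [])
                    ∷ [] ∷ []
      ; walk        = ≤-refl , <⇒≤ u<t , <⇒≤ u<t , tt
      ; alternating = cong₂ _xor_ (t-unmatched v) uv∈M , cong₂ _xor_ uv∈M uv′∉M , tt
      ; a-free = t-free ; b-free = v′-free ; a≢b = λ ()
      ; contains-ut = here refl
      ; short       = ≤-refl
      }

    threeEdgePath-gain : (w : Weights n m) → gain w M threeEdgePath ≡ w t v - (w u v - w u v′)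
    threeEdgePath-gain w = begin
      gain w M threeEdgePath
        ≡⟨ weight-△-gain w M _ ⟩
      toggleGain w M (singleEdge t v ∪ E₂)
        ≡⟨ toggleGain-insert w M (cong₂ _∨_ off-row (cong (_∨ false) off-row)) ⟩
      toggleWeight w M t v + toggleGain w M E₂
        ≡⟨ cong (toggleWeight w M t v +_) (toggleGain-insert w M (cong (_∨ false) off-column)) ⟩
      toggleWeight w M t v + (toggleWeight w M u v + toggleGain w M E₃)
        ≡⟨ cong (λ g → toggleWeight w M t v + (toggleWeight w M u v + g)) (toggleGain-insert w M refl) ⟩
      toggleWeight w M t v + (toggleWeight w M u v + (toggleWeight w M u v′ + toggleGain w M ∅))
        ≡⟨ cong₂ _+_ (toggleWeight-unmatched w M (t-unmatched v))
             (cong₂ _+_ (toggleWeight-matched w M uv∈M)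
               (cong₂ _+_ (toggleWeight-unmatched w M uv′∉M) (toggleGain-∅ w M))) ⟩
      w t v + (- w u v + (w u v′ + 0ℚ))
        ≡⟨ solve 3 (λ x y z → x :+ (:- y :+ (z :+ con 0ℚ)) := x :- (y :- z)) refl (w t v) (w u v) (w u v′) ⟩
      w t v - (w u v - w u v′)
        ∎
      where
      open +-*-Solver using (solve; _:+_; _:-_; :-_; con; _:=_)
      E₃ E₂ : EdgeSet n m
      E₃ = singleEdge u v′ ∪ ∅
      E₂ = singleEdge u v ∪ E₃
      off-row : ∀ {b j} → singleEdge u b t j ≡ false
      off-row = singleEdge-false (t≢u ∘ sym ∘ proj₁)
      off-column : singleEdge u v′ u v ≡ false
      off-column = singleEdge-false (v≢v′ ∘ sym ∘ proj₂)

step-optimal : ∀ {w : Weights n m} {M M′ : EdgeSet n m} {t : Fin n} →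
  Step w M t M′ → (Q : AugPath M t) → gain w M Q Q.≤ weight w M′ - weight w M
step-optimal {w = w} {M} (P , optimal , M′≡) Q =
  subst (gain w M Q Q.≤_) (cong (_- weight w M) (sym (weight-cong w M′≡))) (optimal Q)

matchedBefore-uncovered : ∀ {M : EdgeSet n m} {t : Fin n} → MatchedBefore M (toℕ t) → coveredL M t ≡ false
matchedBefore-uncovered {M = M} {t} before =
  none⇒anyFin≡false (M t) (λ j → ¬-not (<-irrefl refl ∘ before t j))

module _ {w : Weights n m} {M M′ : EdgeSet n m} {t : Fin n}
         (step : Step w M t M′) (before : MatchedBefore M (toℕ t)) where

  private
    t-free : coveredL M t ≡ false
    t-free = matchedBefore-uncovered before

  step-profit≥-unmatched : ∀ {v} → coveredR M v ≡ false → w t v Q.≤ weight w M′ - weight w M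
  step-profit≥-unmatched v-free =
    subst (Q._≤ weight w M′ - weight w M) (edgePath-gain t-free w v-free)
      (step-optimal step (edgePath t-free v-free))

  step-profit≥-matched : ∀ {u v} → M u v ≡ true →
    w t v - (w u v - maxOr0 (maxOn (λ v′ → not (coveredR M v′)) (w u))) Q.≤ weight w M′ - weight w M
  step-profit≥-matched {u} {v} uv∈M with maxOn (λ v′ → not (coveredR M v′)) (w u) in best
  ... | nothing = ⊥-elim (noneFree (augPath-uncoveredRight (proj₁ step)))
    where
    noneFree : ¬ ∃ λ j → coveredR M j ≡ false
    noneFree (j , j-free) = maxOn-nothing _ _ best j (cong not j-free)
  ... | just r with maxOn-just _ _ best
  ...   | v′ , v′-free , wuv′≡r = subst (Q._≤ weight w M′ - weight w M)
          (trans (threeEdgePath-gain t-free u<t uv∈M v′-unmatched w)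
                 (cong (λ x → w t v - (w u v - x)) wuv′≡r))
          (step-optimal step (threeEdgePath t-free u<t uv∈M v′-unmatched))
    where
    u<t : toℕ u < toℕ t
    u<t = before u v uv∈M
    v′-unmatched : coveredR M v′ ≡ false
    v′-unmatched = not-injective v′-free

  step-profit≥ : ∀ v → w t v - loss w M v Q.≤ weight w M′ - weight w M
  step-profit≥ v with findFin (λ i → M i v) in v-match
  ... | nothing = subst (Q._≤ weight w M′ - weight w M) (sym (+-identityʳ (w t v)))
                    (step-profit≥-unmatched (none⇒anyFin≡false (λ i → M i v) (findFin-nothing _ v-match)))
  ... | just u  = step-profit≥-matched (findFin-just _ v-match)

lemma13 : ∀ {n m : ℕ} → n ≤ m →
          (w : Weights n m) → (∀ i j → 0ℚ Q.≤ w i j) →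
          (Ms : ℕ → EdgeSet n m) → IsRun w Ms →
          (Mstar : EdgeSet n m) → IsMaxWeightLPM w Mstar →
          ∀ (t : Fin n) (v : Fin m) → Mstar t v ≡ true →
          w t v - loss w (Ms (toℕ t)) v Q.≤ profit w Ms t
lemma13 _ w _ Ms run@(_ , steps) _ _ t v _ =
  step-profit≥ (steps t) (run-matchedBefore {w = w} {Ms} run (toℕ t) (<⇒≤ (toℕ<n t))) v
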